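{- Let $\alpha(G)$ denote the independence number of a graph $G$. Then (1) $\alpha(D_{2,2})=19$; (2) $\alpha(D_{k,2})\leq\frac{19}{42}|V(D_{k,2})|$ for all $k\geq3$; (3) $\alpha(D_{k,n})\leq\frac{1}{n}|V(D_{k,n})|$ for all $n\geq3$ (and all $k\geq0$).
   Context: DCell $D_{k,n}$ ($n\geq 2$, $k\geq 0$) is defined recursively. $D_{0,n}$ is the complete graph $K_n$ on vertices $0,1,\dots,n-1$. Let $t_{k,n}=|V(D_{k,n})|$. For $k\geq1$, $D_{k,n}$ is built from $t_{k-1,n}+1$ disjoint copies $D^0_{k-1,n},\dots,D^{t_{k-1,n}}_{k-1,n}$ of $D_{k-1,n}$; a vertex of copy $D^i_{k-1,n}$ is labeled $(i,a_{k-1},\dots,a_0)$, where $(a_{k-1},\dots,a_0)$ is its label in $D_{k-1,n}$, and its index within the copy is $uid_{k-1}=a_0+\sum_{l=1}^{k-1}a_l t_{l-1,n}$. For each pair $a<b$ of copy indices, one edge joins the vertex of $D^a_{k-1,n}$ with $uid_{k-1}=b-1$ to the vertex of $D^b_{k-1,n}$ with $uid_{k-1}=a$. $|V(D_{2,2})|=42$. -}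

module Defs where

open import Data.Nat using (ℕ; zero; suc; _+_; _*_; _∸_; _<ᵇ_; _≡ᵇ_; _⊔_)
open import Data.Nat.DivMod using (_/_; _%_)
open import Data.Bool using (Bool; true; false; _∧_; _∨_; not; if_then_else_)
open import Data.Fin using (Fin; toℕ)
open import Data.Fin.Subset using (Subset; ∣_∣)
open import Data.Vec using (Vec; []; _∷_; lookup)
open import Data.List using (List; []; _∷_; map; _++_; foldr; filterᵇ)
open import Data.Bool.ListAction using (all)
open import Data.List using () renaming (allFin to allFinL)

record Graph : Set where
  field
    N   : ℕ
    adj : Fin N → Fin N → Bool
open Graph public

allSubsets : (m : ℕ) → List (Subset m)
allSubsets zero    = [] ∷ []
allSubsets (suc m) = map (true ∷_) (allSubsets m) ++ map (false ∷_) (allSubsets m)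

isIndependent : (G : Graph) → Subset (N G) → Bool
isIndependent G S =
  all (λ u → all (λ v → not (lookup S u ∧ (lookup S v ∧ adj G u v))) (allFinL (N G)))
      (allFinL (N G))

α : Graph → ℕ
α G = foldr _⊔_ 0 (map ∣_∣ (filterᵇ (isIndependent G) (allSubsets (N G))))

-- DCell D_{k,n}.  Vertices are identified with their uid_k ∈ {0,…,t_{k,n}-1};
-- the vertex (i, a_{k-1},…,a_0) of D_{k,n} has uid_k = i * t_{k-1,n} + uid_{k-1}.

t : ℕ → ℕ → ℕ
t zero    n = n
t (suc k) n = t k n * (suc (t k n))   -- (t_{k-1}+1) copies of size t_{k-1}

-- quotient / remainder by T (T = 0 only when there are no vertices)
quo rem : ℕ → ℕ → ℕ
quo zero    u = 0
quo (suc T) u = u / suc T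
rem zero    u = u
rem (suc T) u = u % suc T

dadj : ℕ → ℕ → ℕ → ℕ → Bool
dadj zero    n u v = not (u ≡ᵇ v)
dadj (suc k) n u v =
  let T = t k n
      i = quo T u ; a = rem T u
      j = quo T v ; b = rem T v
  in if i ≡ᵇ j
     then dadj k n a b
     else (((i <ᵇ j) ∧ (a ≡ᵇ (j ∸ 1)) ∧ (b ≡ᵇ i))            -- a<b : (i, uid j-1) ~ (j, uid i)
           ∨ ((j <ᵇ i) ∧ (b ≡ᵇ (i ∸ 1)) ∧ (a ≡ᵇ j)))

DCell : ℕ → ℕ → Graph
DCell k n = record { N = t k n ; adj = λ u v → dadj k n (toℕ u) (toℕ v) }

-- D_{d+K,n} consists of copies of D_{K,n} on consecutive blocks of t_{K,n} uids, and
-- each block induces exactly the adjacency of D_{K,n}.  An independent set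
-- therefore meets every block in at most α(D_{K,n}) vertices, which gives
-- α(D_{d+K,n}) / t_{d+K,n} ≤ α(D_{K,n}) / t_{K,n}.  Blocks of D_{0,n} are cliques, giving (3);
-- blocks of D_{2,2} give (2) once (1) is known.  For (1), an explicit independent set shows
-- 19 ≤ α(D_{2,2}); conversely the 21 pairs {2j, 2j+1} are edges of D_{2,2}, so each pair
-- holds at most one vertex of an independent set, and an exhaustive branch-and-bound
-- search over the pairs, pruned by this count, rules out 20 vertices.

module Submission where

open import Defs
open import Data.Bool using (Bool; true; false; not; _∧_; _∨_; T)
open import Data.Bool.ListAction using (all)
open import Data.Bool.Properties using (T-≡; T-∧; T-∨; T-not-≡; not-involutive)
open import Data.Empty using (⊥; ⊥-elim)
open import Data.Fin using (fromℕ<; toℕ)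
open import Data.Fin.Properties using (toℕ-fromℕ<)
open import Data.Fin.Subset using (Subset; ∣_∣)
open import Data.List using (List; []; _∷_; length; map; filterᵇ)
open import Data.List.Membership.Propositional using (_∈_)
open import Data.List.Membership.Propositional.Properties
  using (∈-allFin; ∈-map⁻; ∈-map⁺; ∈-filter⁻; ∈-filter⁺; ∈-++⁺ˡ; ∈-++⁺ʳ)
open import Data.List.Properties using (foldr-forcesᵇ; foldr-preservesᵇ)
open import Data.List.Relation.Unary.All as All using (All; []; _∷_)
open import Data.List.Relation.Unary.All.Properties using (all⁺; all⁻)
open import Data.List.Relation.Unary.Any using (here)
open import Data.Nat using (ℕ; zero; suc; _+_; _*_; _≤_; _<_; _≤ᵇ_; _≡ᵇ_; z≤n; s≤s; z<s; s<s)
open import Data.Nat.DivMod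
open import Data.Nat.Divisibility using (_∣_; divides; divides-refl; ∣-refl; ∣-trans; m∣m*n)
open import Data.Nat.Properties
open import Algebra.Properties.CommutativeSemigroup +-commutativeSemigroup using (x∙yz≈y∙xz)
open import Data.Nat.Solver using (module +-*-Solver)
open import Data.Product using (_×_; _,_; proj₂)
open import Data.Sum using (inj₁; inj₂)
open import Data.Vec using (Vec; []; _∷_; lookup)
open import Function using (_∘_)
open import Function.Bundles using (Equivalence)
open import Relation.Nullary using (¬_)
open import Relation.Nullary.Decidable using (T?)
open import Relation.Binary.PropositionalEquality
open +-*-Solver using (solve; _:+_; _:*_; _:=_)

∈-allSubsets : ∀ {m} (S : Subset m) → S ∈ allSubsets m
∈-allSubsets []          = here refl
∈-allSubsets (true ∷ S)  = ∈-++⁺ˡ (∈-map⁺ (true ∷_) (∈-allSubsets S))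
∈-allSubsets (false ∷ S) = ∈-++⁺ʳ _ (∈-map⁺ (false ∷_) (∈-allSubsets S))

α-≤ : ∀ G {c} → (∀ S → T (isIndependent G S) → ∣ S ∣ ≤ c) → α G ≤ c
α-≤ G bound = foldr-preservesᵇ ⊔-lub z≤n (All.tabulate {xs = independentSizes} λ x∈ →
  let S , S∈ , x≡∣S∣ = ∈-map⁻ ∣_∣ x∈
      S-indep = proj₂ (∈-filter⁻ (T? ∘ isIndependent G) {xs = allSubsets (N G)} S∈)
  in subst (_≤ _) (sym x≡∣S∣) (bound S S-indep))
  where independentSizes = map ∣_∣ (filterᵇ (isIndependent G) (allSubsets (N G)))

≤-α : ∀ G S → T (isIndependent G S) → ∣ S ∣ ≤ α G
≤-α G S indep = All.lookup
  (foldr-forcesᵇ (λ x y x⊔y≤ → m⊔n≤o⇒m≤o x y x⊔y≤ , m⊔n≤o⇒n≤o x y x⊔y≤) 0 _ ≤-refl)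
  (∈-map⁺ ∣_∣ (∈-filter⁺ (T? ∘ isIndependent G) (∈-allSubsets S) indep))

bit : Bool → ℕ
bit true  = 1
bit false = 0

count : (ℕ → Bool) → ℕ → ℕ
count F zero    = 0
count F (suc n) = count F n + bit (F n)

count-+ : ∀ F m n → count F (m + n) ≡ count F m + count (λ i → F (m + i)) n
count-+ F m zero    = trans (cong (count F) (+-identityʳ m)) (sym (+-identityʳ _))
count-+ F m (suc n) = begin
  count F (m + suc n)                                       ≡⟨ cong (count F) (+-suc m n) ⟩
  count F (m + n) + bit (F (m + n))                         ≡⟨ cong (_+ bit (F (m + n))) (count-+ F m n) ⟩
  count F m + count (λ i → F (m + i)) n + bit (F (m + n))   ≡⟨ +-assoc (count F m) _ _ ⟩
  count F m + count (λ i → F (m + i)) (suc n)               ∎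
  where open ≡-Reasoning

count-cong : ∀ {F G} → (∀ i → F i ≡ G i) → ∀ n → count F n ≡ count G n
count-cong F≗G zero    = refl
count-cong F≗G (suc n) = cong₂ _+_ (count-cong F≗G n) (cong bit (F≗G n))

count-blocks : ∀ F b c M → (∀ j → j < M → count (λ i → F (i + j * b)) b ≤ c) → count F (M * b) ≤ M * c
count-blocks F b c zero    _     = z≤n
count-blocks F b c (suc M) block = begin
  count F (b + M * b)                         ≡⟨ count-+ F b (M * b) ⟩
  count F b + count (λ i → F (b + i)) (M * b) ≤⟨ +-mono-≤ first rest ⟩
  c + M * c                                   ∎
  where
  open ≤-Reasoning
  first : count F b ≤ c
  first = subst (_≤ c) (count-cong (λ i → cong F (+-identityʳ i)) b) (block 0 z<s)
  rest : count (λ i → F (b + i)) (M * b) ≤ M * c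
  rest = count-blocks (λ i → F (b + i)) b c M λ j j<M →
    subst (_≤ c) (count-cong (λ i → cong F (x∙yz≈y∙xz i b (j * b))) b) (block (suc j) (s<s j<M))

count-≡0 : ∀ {F} n → (∀ {i} → i < n → ¬ T (F i)) → count F n ≡ 0
count-≡0 zero _ = refl
count-≡0 {F} (suc n) none with F n in Fn
... | true  = ⊥-elim (none ≤-refl (subst T (sym Fn) _))
... | false = trans (+-identityʳ _) (count-≡0 n (none ∘ m≤n⇒m≤1+n))

count-≤1 : ∀ {F} n → (∀ {i j} → i < n → j < n → T (F i) → T (F j) → i ≡ j) → count F n ≤ 1
count-≤1 zero _ = z≤n
count-≤1 {F} (suc n) unique with F n in Fn
... | false = ≤-trans (≤-reflexive (+-identityʳ _))
                (count-≤1 n λ i< j< → unique (m≤n⇒m≤1+n i<) (m≤n⇒m≤1+n j<))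
... | true  = ≤-reflexive (cong (_+ 1) (count-≡0 n λ i<n Fi →
                <⇒≢ i<n (unique (m≤n⇒m≤1+n i<n) ≤-refl Fi (subst T (sym Fn) _))))

at : ∀ {n} → Vec Bool n → ℕ → Bool
at []      _       = false
at (x ∷ _) zero    = x
at (_ ∷ v) (suc i) = at v i

at-fromℕ< : ∀ {n} (v : Vec Bool n) {i} (i<n : i < n) → at v i ≡ lookup v (fromℕ< i<n)
at-fromℕ< (x ∷ v) {zero}  z<s       = refl
at-fromℕ< (x ∷ v) {suc i} (s<s i<n) = at-fromℕ< v i<n

∣∣≡count-at : ∀ {n} (S : Subset n) → ∣ S ∣ ≡ count (at S) n
∣∣≡count-at []               = refl
∣∣≡count-at {suc n} (x ∷ S) = trans (head x) (sym (count-+ (at (x ∷ S)) 1 n))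
  where
  head : ∀ x → ∣ x ∷ S ∣ ≡ bit x + count (at S) n
  head true  = cong suc (∣∣≡count-at S)
  head false = ∣∣≡count-at S

IndependentBelow : ℕ → (ℕ → ℕ → Bool) → (ℕ → Bool) → Set
IndependentBelow N A F = ∀ {u v} → u < N → v < N → T (F u) → T (F v) → T (not (A u v))

not-∧-elim : ∀ {x y z} → T x → T y → T (not (x ∧ (y ∧ z))) → T (not z)
not-∧-elim {true} {true} _ _ h = h

isIndependent⇒IndependentBelow : ∀ G {A} → (∀ i j → adj G i j ≡ A (toℕ i) (toℕ j)) →
                                 ∀ S → T (isIndependent G S) → IndependentBelow (N G) A (at S)
isIndependent⇒IndependentBelow G {A} adj≡A S indep {u} {v} u< v< Su Sv =
  subst (T ∘ not) (trans (adj≡A i j) (cong₂ A (toℕ-fromℕ< u<) (toℕ-fromℕ< v<)))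
    (not-∧-elim (subst T (at-fromℕ< S u<) Su) (subst T (at-fromℕ< S v<) Sv) edge-free)
  where
  i = fromℕ< u<
  j = fromℕ< v<
  edge-free : T (not (lookup S i ∧ (lookup S j ∧ adj G i j)))
  edge-free = All.lookup (all⁺ _ _ (All.lookup (all⁺ _ _ indep) (∈-allFin i))) (∈-allFin j)

t-∣ : ∀ d k n → t k n ∣ t (d + k) n
t-∣ zero    k n = ∣-refl
t-∣ (suc d) k n = ∣-trans (t-∣ d k n) (m∣m*n (suc (t (d + k) n)))

quo[x+q*m]≡q : ∀ m q {x} → x < m → quo m (x + q * m) ≡ q
quo[x+q*m]≡q m@(suc _) q {x} x<m = begin
  (x + q * m) / m      ≡⟨ +-distrib-/-∣ʳ x (divides-refl q) ⟩
  x / m + q * m / m    ≡⟨ cong₂ _+_ (m<n⇒m/n≡0 x<m) (m*n/n≡m q m) ⟩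
  q                    ∎
  where open ≡-Reasoning

rem[x+q*m]≡x : ∀ m q {x} → x < m → rem m (x + q * m) ≡ x
rem[x+q*m]≡x m@(suc _) q {x} x<m = trans ([m+kn]%n≡m%n x q m) (m<n⇒m%n≡m x<m)

dadj-copy : ∀ k n q {x y} → x < t k n → y < t k n →
            dadj (suc k) n (x + q * t k n) (y + q * t k n) ≡ dadj k n x y
dadj-copy k n q {x} {y} x<t y<t
  rewrite quo[x+q*m]≡q (t k n) q x<t | quo[x+q*m]≡q (t k n) q y<t
        | rem[x+q*m]≡x (t k n) q x<t | rem[x+q*m]≡x (t k n) q y<t
        | Equivalence.to T-≡ (≡⇒≡ᵇ q q refl) = refl

x+j*b<M*b : ∀ {x b j M} → x < b → j < M → x + j * b < M * b
x+j*b<M*b {x} {b} {j} {M} x<b j<M = begin-strict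
  x + j * b  <⟨ +-monoˡ-< (j * b) x<b ⟩
  suc j * b  ≤⟨ *-monoˡ-≤ b j<M ⟩
  M * b      ∎
  where open ≤-Reasoning

dadj-block : ∀ d {K n} j {a a'} → a < t K n → a' < t K n → j * t K n < t (d + K) n →
             dadj (d + K) n (a + j * t K n) (a' + j * t K n) ≡ dadj K n a a'
dadj-block zero {K} {n} zero {a} {a'} _ _ _ = cong₂ (dadj K n) (+-identityʳ a) (+-identityʳ a')
dadj-block zero {K} {n} (suc j) _ _ jb<b = ⊥-elim (<⇒≱ jb<b (m≤m+n (t K n) (j * t K n)))
dadj-block (suc d) {K} {n} j {a} {a'} a<tK a'<tK jtK<t with t-∣ d K n
... | divides zero tD≡0 = ⊥-elim (n≮0 (subst (λ tD → j * t K n < tD * suc tD) tD≡0 jtK<t))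
... | divides M@(suc _) tD≡MtK = begin
  dadj (suc D) n (a + j * tK) (a' + j * tK)                   ≡⟨ cong₂ (dadj (suc D) n) (split a) (split a') ⟩
  dadj (suc D) n (a + r * tK + q * tD) (a' + r * tK + q * tD) ≡⟨ dadj-copy D n q (in-copy a<tK) (in-copy a'<tK) ⟩
  dadj D n (a + r * tK) (a' + r * tK)                         ≡⟨ dadj-block d r a<tK a'<tK r*tK<tD ⟩
  dadj K n a a'                                               ∎
  where
  open ≡-Reasoning
  D = d + K
  tD = t D n
  tK = t K n
  r = j % M
  q = j / M
  in-copy : ∀ {x} → x < tK → x + r * tK < tD
  in-copy {x} x<tK = subst (x + r * tK <_) (sym tD≡MtK) (x+j*b<M*b x<tK (m%n<n j M))
  r*tK<tD : r * tK < tD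
  r*tK<tD = ≤-<-trans (m≤n+m (r * tK) a) (in-copy a<tK)
  split : ∀ x → x + j * tK ≡ x + r * tK + q * tD
  split x = begin
    x + j * tK                 ≡⟨ cong (λ j → x + j * tK) (m≡m%n+[m/n]*n j M) ⟩
    x + (r + q * M) * tK
      ≡⟨ solve 5 (λ x r q M b → x :+ (r :+ q :* M) :* b := x :+ r :* b :+ q :* (M :* b)) refl x r q M tK ⟩
    x + r * tK + q * (M * tK)  ≡⟨ cong (λ tD → x + r * tK + q * tD) tD≡MtK ⟨
    x + r * tK + q * tD        ∎

IndependenceBound : ℕ → ℕ → ℕ → Set
IndependenceBound k n c = ∀ F → IndependentBelow (t k n) (dadj k n) F → count F (t k n) ≤ c

α-DCell-≤ : ∀ {k n c} → IndependenceBound k n c → α (DCell k n) ≤ c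
α-DCell-≤ {k} {n} bound = α-≤ (DCell k n) λ S indep →
  subst (_≤ _) (sym (∣∣≡count-at S))
    (bound (at S) (isIndependent⇒IndependentBelow (DCell k n) (λ _ _ → refl) S indep))

IndependenceBound-lift : ∀ d {K n c M} → t (d + K) n ≡ M * t K n →
                         IndependenceBound K n c → IndependenceBound (d + K) n (M * c)
IndependenceBound-lift d {K} {n} {c} {M} t≡MtK bound F indep =
  subst (λ s → count F s ≤ M * c) (sym t≡MtK)
    (count-blocks F (t K n) c M λ j j<M → bound (λ i → F (i + j * t K n)) (copy-indep j<M))
  where
  copy-indep : ∀ {j} → j < M → IndependentBelow (t K n) (dadj K n) (λ i → F (i + j * t K n))
  copy-indep {j} j<M {u} u<tK v<tK Fu Fv =
    subst (T ∘ not) (dadj-block d j u<tK v<tK (≤-<-trans (m≤n+m _ u) (in-D u<tK)))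
      (indep (in-D u<tK) (in-D v<tK) Fu Fv)
    where
    in-D : ∀ {x} → x < t K n → x + j * t K n < t (d + K) n
    in-D {x} x<tK = subst (x + j * t K n <_) (sym t≡MtK) (x+j*b<M*b x<tK j<M)

IndependenceBound-complete : ∀ n → IndependenceBound 0 n 1
IndependenceBound-complete n F indep = count-≤1 n λ {i} {j} i<n j<n Fi Fj →
  ≡ᵇ⇒≡ i j (subst T (not-involutive (i ≡ᵇ j)) (indep i<n j<n Fi Fj))

α-DCell-density : ∀ d {K n c} → IndependenceBound K n c → t K n * α (DCell (d + K) n) ≤ c * t (d + K) n
α-DCell-density d {K} {n} {c} bound with t-∣ d K n
... | divides M t≡MtK = begin
  t K n * α (DCell (d + K) n)
    ≤⟨ *-monoʳ-≤ (t K n) (α-DCell-≤ {d + K} (IndependenceBound-lift d {K} {n} {c} {M} t≡MtK bound)) ⟩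
  t K n * (M * c)              ≡⟨ solve 3 (λ b M c → b :* (M :* c) := c :* (M :* b)) refl (t K n) M c ⟩
  c * (M * t K n)              ≡⟨ cong (c *_) t≡MtK ⟨
  c * t (d + K) n              ∎
  where open ≤-Reasoning

T-not∨ : ∀ {x y} → T x → T (not x ∨ y) → T y
T-not∨ {true} _ h = h

module PairSearch (A : ℕ → ℕ → Bool) (c : ℕ) where

  compatible : ℕ → List ℕ → Bool
  compatible u = all (λ v → not (A u v))

  -- The first disjunct prunes: the m pairs below 2m hold at most m more vertices.
  mutual
    bounded : ℕ → List ℕ → Bool
    bounded zero    X = length X ≤ᵇ c
    bounded (suc m) X =
      (suc m + length X ≤ᵇ c) ∨ (bounded m X ∧ (boundedWith m X (m * 2) ∧ boundedWith m X (suc (m * 2))))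

    boundedWith : ℕ → List ℕ → ℕ → Bool
    boundedWith m X u = not (compatible u X) ∨ bounded m (u ∷ X)

  module _ {M F} (pair : ∀ {j} → j < M → T (A (j * 2) (suc (j * 2))))
                 (indep : IndependentBelow (M * 2) A F) where

    Chosen : ℕ → Set
    Chosen v = v < M * 2 × T (F v)

    odd<M*2 : ∀ {m} → m < M → suc (m * 2) < M * 2
    odd<M*2 m<M = *-monoˡ-≤ 2 m<M

    even<M*2 : ∀ {m} → m < M → m * 2 < M * 2
    even<M*2 m<M = <⇒≤ (odd<M*2 m<M)

    pair-exclusive : ∀ {m} → m < M → T (F (m * 2)) → T (F (suc (m * 2))) → ⊥
    pair-exclusive m<M F₀ F₁ =
      subst T (Equivalence.to T-not-≡ (indep (even<M*2 m<M) (odd<M*2 m<M) F₀ F₁)) (pair m<M)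

    count-pair : ∀ m → count F (suc m * 2) ≡ count F (m * 2) + (bit (F (m * 2)) + bit (F (suc (m * 2))))
    count-pair m = +-assoc (count F (m * 2)) _ _

    pair-bits≤1 : ∀ {m} → m < M → bit (F (m * 2)) + bit (F (suc (m * 2))) ≤ 1
    pair-bits≤1 {m} m<M with F (m * 2) in F₀ | F (suc (m * 2)) in F₁
    ... | true  | true  = ⊥-elim (pair-exclusive m<M (subst T (sym F₀) _) (subst T (sym F₁) _))
    ... | true  | false = ≤-refl
    ... | false | true  = ≤-refl
    ... | false | false = z≤n

    count-pairs≤ : ∀ m → m ≤ M → count F (m * 2) ≤ m
    count-pairs≤ zero    _   = z≤n
    count-pairs≤ (suc m) m<M = begin
      count F (suc m * 2)                                          ≡⟨ count-pair m ⟩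
      count F (m * 2) + (bit (F (m * 2)) + bit (F (suc (m * 2))))
        ≤⟨ +-mono-≤ (count-pairs≤ m (<⇒≤ m<M)) (pair-bits≤1 m<M) ⟩
      m + 1                                                        ≡⟨ +-comm m 1 ⟩
      suc m                                                        ∎
      where open ≤-Reasoning

    compatible-chosen : ∀ {u X} → Chosen u → All Chosen X → T (compatible u X)
    compatible-chosen (u< , Fu) chosen = all⁻ _ (All.map (λ (v< , Fv) → indep u< v< Fu Fv) chosen)

    mutual
      bounded-sound : ∀ m X → m ≤ M → All Chosen X → T (bounded m X) → count F (m * 2) + length X ≤ c
      bounded-sound zero    X _   _      h = ≤ᵇ⇒≤ _ c h
      bounded-sound (suc m) X m<M chosen h with Equivalence.to T-∨ h
      ... | inj₁ few = ≤-trans (+-monoˡ-≤ (length X) (count-pairs≤ (suc m) m<M)) (≤ᵇ⇒≤ _ c few)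
      ... | inj₂ branches with Equivalence.to (T-∧ {bounded m X}) branches
      ...   | skip , extensions with Equivalence.to (T-∧ {boundedWith m X (m * 2)}) extensions
      ...     | with-even , with-odd =
        subst (λ s → s + length X ≤ c) (sym (count-pair m)) (pair-step m X m<M chosen skip with-even with-odd)

      pair-step : ∀ m X → m < M → All Chosen X → T (bounded m X) →
                  T (boundedWith m X (m * 2)) → T (boundedWith m X (suc (m * 2))) →
                  count F (m * 2) + (bit (F (m * 2)) + bit (F (suc (m * 2)))) + length X ≤ c
      pair-step m X m<M chosen skip with-even with-odd with F (m * 2) in F₀ | F (suc (m * 2)) in F₁
      ... | true  | true  = ⊥-elim (pair-exclusive m<M (subst T (sym F₀) _) (subst T (sym F₁) _))
      ... | false | false = subst (λ s → s + length X ≤ c) (sym (+-identityʳ _))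
                              (bounded-sound m X (<⇒≤ m<M) chosen skip)
      ... | true  | false = subst (_≤ c) (sym (+-assoc _ 1 (length X)))
                              (bounded-sound m _ (<⇒≤ m<M) (even ∷ chosen)
                                 (T-not∨ (compatible-chosen even chosen) with-even))
        where even = even<M*2 m<M , subst T (sym F₀) _
      ... | false | true  = subst (_≤ c) (sym (+-assoc _ 1 (length X)))
                              (bounded-sound m _ (<⇒≤ m<M) (odd ∷ chosen)
                                 (T-not∨ (compatible-chosen odd chosen) with-odd))
        where odd = odd<M*2 m<M , subst T (sym F₁) _

open PairSearch using (bounded-sound)

IndependenceBound-D₂,₂ : IndependenceBound 2 2 19
IndependenceBound-D₂,₂ F indep =
  subst (_≤ 19) (+-identityʳ _) (bounded-sound (dadj 2 2) 19 pair indep 21 [] ≤-refl [] _)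
  where
  pair : ∀ {j} → j < 21 → T (dadj 2 2 (j * 2) (suc (j * 2)))
  pair {j} j<21 = subst T (sym (dadj-block 2 {0} {2} j {0} {1} z<s (s<s z<s) (*-monoˡ-< 2 j<21))) _

W₁₉ : Subset 42
W₁₉ = true ∷ false ∷ false ∷ true ∷ true ∷ false ∷ false ∷ true ∷ true ∷ false ∷ false ∷ true ∷ true ∷ false ∷
      false ∷ false ∷ false ∷ true ∷ true ∷ false ∷ false ∷ true ∷ true ∷ false ∷ false ∷ true ∷ true ∷ false ∷
      false ∷ true ∷ false ∷ true ∷ true ∷ false ∷ false ∷ true ∷ true ∷ false ∷ false ∷ true ∷ false ∷ false ∷ []

α-D₂,₂ : α (DCell 2 2) ≡ 19
α-D₂,₂ = ≤-antisym (α-DCell-≤ {2} {2} {19} IndependenceBound-D₂,₂) (≤-α (DCell 2 2) W₁₉ _)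

lemma21 : (α (DCell 2 2) ≡ 19)
          × (∀ k → 3 ≤ k → 42 * α (DCell k 2) ≤ 19 * N (DCell k 2))
          × (∀ k n → 3 ≤ n → n * α (DCell k n) ≤ N (DCell k n))
lemma21 = α-D₂,₂ , α-Dₖ,₂ , α-Dₖ,ₙ
  where
  α-Dₖ,₂ : ∀ k → 3 ≤ k → 42 * α (DCell k 2) ≤ 19 * N (DCell k 2)
  α-Dₖ,₂ (suc (suc (suc d))) (s≤s (s≤s (s≤s _))) =
    subst (λ k → 42 * α (DCell k 2) ≤ 19 * N (DCell k 2)) (+-comm (suc d) 2)
      (α-DCell-density (suc d) IndependenceBound-D₂,₂)

  -- The bound holds for every n.
  α-Dₖ,ₙ : ∀ k n → 3 ≤ n → n * α (DCell k n) ≤ N (DCell k n)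
  α-Dₖ,ₙ k n _ =
    subst (λ k → n * α (DCell k n) ≤ N (DCell k n)) (+-identityʳ k)
      (≤-trans (α-DCell-density k (IndependenceBound-complete n)) (≤-reflexive (*-identityˡ _)))
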